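{- Let $m<n$, let $\mu\in(\mathbb{Z}_{\ge0})^n$, let $\pi_1$ be a permutation of $[m]$ and $\pi_2$ a permutation of $\{m+1,\dotsc,n\}$. Then $|\mathrm{NAF}_\mu^{\pi_1\pi_2}|=|\mathrm{NAF}_\mu^{\pi_1^c\pi_2^c}|$.
   Context: $\pi_1\pi_2\in S_n$ is the concatenation ($i\mapsto\pi_1(i)$ for $i\le m$, $i\mapsto\pi_2(i)$ for $i>m$). For a permutation $\rho$ of $[a,b]=\{a,\dotsc,b\}$, $\rho^c(i)=a+b-\rho(i)$. For $\mu\in(\mathbb{Z}_{\ge0})^n$: $\mathrm{dg}'(\mu)=\{(i,j):1\le i\le n,\ 1\le j\le\mu_i\}$, $\hat{\mathrm{dg}}(\mu)=\mathrm{dg}'(\mu)\cup\{(i,0):1\le i\le n\}$. An augmented filling with basement $\pi\in S_n$ is a map $\hat\sigma:\hat{\mathrm{dg}}(\mu)\to[n]$ with $\hat\sigma(i,0)=\pi(i)$ for all $i$. Two distinct boxes attack each other if they are in the same row, or have the form $(i,j),(i',j-1)$ with $i'>i$. $\mathrm{NAF}^\pi_\mu$ is the set of augmented fillings with basement $\pi$ taking distinct values on every pair of attacking boxes. -}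

module Defs where

open import Data.Nat using (ℕ; zero; suc; _+_)
open import Data.Fin using (Fin; toℕ; splitAt; join; opposite; _<?_)
open import Data.Fin.Properties using () renaming (_≟_ to _≟F_)
open import Data.Sum using (_⊎_; inj₁; inj₂)
open import Data.Sum.Base as Sum using ()
open import Data.Bool using (Bool; true; false; _∧_; not; T)
open import Data.List using (List; allFin; foldr; map)
open import Data.Vec using (Vec; lookup; head)
open import Data.Vec.Relation.Unary.All using (All; _∷_)
import Data.Fin as Fin
import Data.Vec.Relation.Unary.All as All
open import Data.Nat.Properties using () renaming (_≟_ to _≟ℕ_)
open import Data.Product using (Σ)
open import Relation.Nullary.Decidable using (does)
open import Function.Bundles using (Bijection)

all : {A : Set} → (A → Bool) → List A → Bool
all p xs = foldr _∧_ true (map p xs)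

-- Conventions: [n] = {1,…,n} is encoded as Fin n (value v ∈ Fin n stands
-- for v+1).  Columns i ∈ Fin n, μ : Vec ℕ n, box (i,j) with 0 ≤ j ≤ μ_i.

-- Concatenation π₁π₂ ∈ S_(m+k) of π₁ : [m] → [m] and π₂ : [m+1,m+k] → [m+1,m+k],
-- where π₂ is encoded as a map Fin k → Fin k (shifted by m).
concatPerm : ∀ m k → (Fin m → Fin m) → (Fin k → Fin k) → Fin (m + k) → Fin (m + k)
concatPerm m k π₁ π₂ i = join m k (Sum.map π₁ π₂ (splitAt m i))

-- ρ^c(i) = a + b − ρ(i); on the encoded interval this is `opposite ∘ ρ`.
compl : ∀ {m} → (Fin m → Fin m) → Fin m → Fin m
compl ρ i = opposite (ρ i)

-- An augmented filling of shape μ: column i is a vector of length μ_i + 1,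
-- entry j being σ̂(i,j) (j = 0 is the basement row).
AugFilling : ∀ n → Vec ℕ n → Set
AugFilling n μ = All (λ h → Vec (Fin n) (suc h)) μ

column : ∀ {A : Set} {n} {μ : Vec ℕ n} → All (λ h → Vec A (suc h)) μ → (i : Fin n) → Vec A (suc (lookup μ i))
column (c ∷ _) Fin.zero = c
column (_ ∷ σ) (Fin.suc i) = column σ i

entry : ∀ {n} {μ : Vec ℕ n} → AugFilling n μ → (i : Fin n) → Fin (suc (lookup μ i)) → Fin n
entry σ i j = lookup (column σ i) j

_≠ᵇ_ : ∀ {n} → Fin n → Fin n → Bool
a ≠ᵇ b = not (does (a ≟F b))

_=ℕᵇ_ : ℕ → ℕ → Bool
a =ℕᵇ b = does (a ≟ℕ b)

_⇒ᵇ_ : Bool → Bool → Bool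
a ⇒ᵇ b = not a Data.Bool.∨ b

hasBasement : ∀ {n} {μ : Vec ℕ n} → (Fin n → Fin n) → AugFilling n μ → Bool
hasBasement π σ = all (λ i → does (head (column σ i) ≟F π i)) (allFin _)

nonAttacking : ∀ {n} {μ : Vec ℕ n} → AugFilling n μ → Bool
nonAttacking {n} {μ} σ =
  all (λ i → all (λ i' →
    all (λ j → all (λ j' →
      ((not (does (i ≟F i')) ∧ (toℕ j =ℕᵇ toℕ j')) ⇒ᵇ (entry σ i j ≠ᵇ entry σ i' j'))
      ∧ ((does (i <? i') ∧ (toℕ j =ℕᵇ suc (toℕ j'))) ⇒ᵇ (entry σ i j ≠ᵇ entry σ i' j')))
      (allFin (suc (lookup μ i'))))
      (allFin (suc (lookup μ i))))
    (allFin n))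
  (allFin n)

NAF : ∀ {n} → (Fin n → Fin n) → Vec ℕ n → Set
NAF {n} π μ = Σ (AugFilling n μ) (λ σ → T (hasBasement π σ ∧ nonAttacking σ))

-- Non-attackingness only asks that certain pairs of entries differ, so
-- relabelling every entry of a filling by a permutation φ of the values
-- is a bijection from NAF^π_μ onto NAF^(φ∘π)_μ.  Complementing both blocks
-- of π₁π₂ is post-composition with the permutation that reverses each of
-- the blocks [1,m] and [m+1,n].
module Submission where

open import Defs
open import Data.Nat using (ℕ; suc; _+_; _<_)
open import Data.Bool using (Bool; true; _∧_; not; T)
open import Data.Bool.Properties using (T-irrelevant)
open import Data.Fin using (Fin; toℕ; _<?_; splitAt; join; opposite)
import Data.Fin as Fin
open import Data.Fin.Properties using (splitAt-join; +↔⊎) renaming (_≟_ to _≟F_)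
open import Data.Fin.Permutation
  using (Permutation′; _⟨$⟩ʳ_; _⟨$⟩ˡ_; inverseˡ; inverseʳ; reverse; flip)
open import Data.List using (allFin; foldr)
import Data.List.Properties as List
open import Data.Product using (_,_)
import Data.Sum.Base as Sum
open import Data.Sum.Properties using (map-map)
open import Data.Sum.Function.Propositional using (_⊎-↔_)
open import Data.Vec using (Vec; _∷_; lookup; head)
import Data.Vec as Vec
open import Data.Vec.Properties using (lookup-map; map-∘; map-cong; map-id)
open import Data.Vec.Relation.Unary.All using (All; []; _∷_)
import Data.Vec.Relation.Unary.All as All
open import Function using (_∘_; _$_)
open import Function.Bundles using (_⤖_; mk↔ₛ′; Injection)
open import Function.Construct.Composition using (_↔-∘_)
open import Function.Construct.Symmetry using (↔-sym)
open import Function.Definitions using (Injective)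
open import Function.Properties.Inverse using (↔⇒⤖; ↔⇒↣)
open import Relation.Binary.PropositionalEquality
open import Relation.Nullary.Decidable using (does; yes; no; dec-true; dec-false)

all-cong : {A : Set} {f g : A → Bool} → f ≗ g → all f ≗ all g
all-cong f≗g xs = cong (foldr _∧_ true) (List.map-cong f≗g xs)

does-≟-injective : ∀ {n} {f : Fin n → Fin n} → Injective _≡_ _≡_ f →
                   ∀ a b → does (f a ≟F f b) ≡ does (a ≟F b)
does-≟-injective {f = f} f-inj a b with a ≟F b
... | yes refl = dec-true (f a ≟F f a) refl
... | no a≢b = dec-false (f a ≟F f b) (a≢b ∘ f-inj)

relabel : ∀ {A B : Set} {ℓ} {μ : Vec ℕ ℓ} → (A → B) →
          All (λ h → Vec A (suc h)) μ → All (λ h → Vec B (suc h)) μ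
relabel f = All.map (Vec.map f)

column-relabel : ∀ {A B : Set} {ℓ} {μ : Vec ℕ ℓ} (f : A → B) (σ : All (λ h → Vec A (suc h)) μ) i →
                 column (relabel f σ) i ≡ Vec.map f (column σ i)
column-relabel f (c ∷ σ) Fin.zero = refl
column-relabel f (c ∷ σ) (Fin.suc i) = column-relabel f σ i

entry-relabel : ∀ {n} {μ : Vec ℕ n} (f : Fin n → Fin n) (σ : AugFilling n μ) i j →
                entry (relabel f σ) i j ≡ f (entry σ i j)
entry-relabel f σ i j = begin
  lookup (column (relabel f σ) i) j   ≡⟨ cong (λ v → lookup v j) (column-relabel f σ i) ⟩
  lookup (Vec.map f (column σ i)) j   ≡⟨ lookup-map j f (column σ i) ⟩
  f (entry σ i j)                     ∎
  where open ≡-Reasoning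

head-map : ∀ {A B : Set} {ℓ} (f : A → B) (v : Vec A (suc ℓ)) → head (Vec.map f v) ≡ f (head v)
head-map f (x ∷ v) = refl

relabel-inverse : ∀ {A B : Set} {ℓ} {μ : Vec ℕ ℓ} {f : A → B} {g : B → A} → (∀ x → g (f x) ≡ x) →
                  (σ : All (λ h → Vec A (suc h)) μ) → relabel g (relabel f σ) ≡ σ
relabel-inverse g∘f≗id [] = refl
relabel-inverse {f = f} {g} g∘f≗id (c ∷ σ) = cong₂ _∷_ map-map-inverse (relabel-inverse g∘f≗id σ)
  where
  open ≡-Reasoning
  map-map-inverse : Vec.map g (Vec.map f c) ≡ c
  map-map-inverse = begin
    Vec.map g (Vec.map f c)  ≡⟨ map-∘ g f c ⟨
    Vec.map (g ∘ f) c        ≡⟨ map-cong g∘f≗id c ⟩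
    Vec.map (λ x → x) c      ≡⟨ map-id c ⟩
    c                        ∎

module _ {n} {μ : Vec ℕ n} {f : Fin n → Fin n} (f-inj : Injective _≡_ _≡_ f) where

  nonAttacking-relabel : (σ : AugFilling n μ) → nonAttacking (relabel f σ) ≡ nonAttacking σ
  nonAttacking-relabel σ =
    all-cong (λ i → all-cong (λ i' → all-cong (λ j → all-cong (λ j' →
      cong (λ b → ((not (does (i ≟F i')) ∧ (toℕ j =ℕᵇ toℕ j')) ⇒ᵇ b)
                ∧ ((does (i <? i') ∧ (toℕ j =ℕᵇ suc (toℕ j'))) ⇒ᵇ b))
           (entries-≠ᵇ i i' j j'))
      (allFin (suc (lookup μ i')))) (allFin (suc (lookup μ i)))) (allFin n)) (allFin n)
    where
    entries-≠ᵇ : ∀ i i' j j' →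
                 (entry (relabel f σ) i j ≠ᵇ entry (relabel f σ) i' j') ≡ (entry σ i j ≠ᵇ entry σ i' j')
    entries-≠ᵇ i i' j j' rewrite entry-relabel f σ i j | entry-relabel f σ i' j' =
      cong not (does-≟-injective f-inj _ _)

  hasBasement-relabel : ∀ {π π'} → (∀ i → π' i ≡ f (π i)) →
                        (σ : AugFilling n μ) → hasBasement π' (relabel f σ) ≡ hasBasement π σ
  hasBasement-relabel {π} {π'} π'≗fπ σ = all-cong basement-entry (allFin n)
    where
    basement-entry : ∀ i → does (head (column (relabel f σ) i) ≟F π' i) ≡ does (head (column σ i) ≟F π i)
    basement-entry i = begin
      does (head (column (relabel f σ) i) ≟F π' i)    ≡⟨ cong (λ c → does (head c ≟F π' i)) (column-relabel f σ i) ⟩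
      does (head (Vec.map f (column σ i)) ≟F π' i)    ≡⟨ cong₂ (λ a b → does (a ≟F b)) (head-map f (column σ i)) (π'≗fπ i) ⟩
      does (f (head (column σ i)) ≟F f (π i))         ≡⟨ does-≟-injective f-inj (head (column σ i)) (π i) ⟩
      does (head (column σ i) ≟F π i)                 ∎
      where open ≡-Reasoning

  NAF-relabel : ∀ {π π'} → (∀ i → π' i ≡ f (π i)) → NAF π μ → NAF π' μ
  NAF-relabel π'≗fπ (σ , valid) =
    relabel f σ , subst T (sym (cong₂ _∧_ (hasBasement-relabel π'≗fπ σ) (nonAttacking-relabel σ))) valid

NAF-≡ : ∀ {n} {μ : Vec ℕ n} {π} {σ σ' : AugFilling n μ} → σ ≡ σ' →
        (p : T (hasBasement π σ ∧ nonAttacking σ)) (q : T (hasBasement π σ' ∧ nonAttacking σ')) →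
        _≡_ {A = NAF π μ} (σ , p) (σ' , q)
NAF-≡ refl p q = cong (_ ,_) (T-irrelevant p q)

NAF-relabel-⤖ : ∀ {n} {μ : Vec ℕ n} {π π'} (φ : Permutation′ n) → (∀ i → π' i ≡ φ ⟨$⟩ʳ π i) →
                NAF π μ ⤖ NAF π' μ
NAF-relabel-⤖ φ π'≗φπ = ↔⇒⤖ $ mk↔ₛ′
  (NAF-relabel (Injection.injective (↔⇒↣ φ)) π'≗φπ)
  (NAF-relabel (Injection.injective (↔⇒↣ (flip φ))) π≗φ⁻¹π')
  (λ { (σ , _) → NAF-≡ (relabel-inverse (λ _ → inverseʳ φ) σ) _ _ })
  (λ { (σ , _) → NAF-≡ (relabel-inverse (λ _ → inverseˡ φ) σ) _ _ })
  where
  π≗φ⁻¹π' : ∀ i → _ ≡ φ ⟨$⟩ˡ _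
  π≗φ⁻¹π' i = trans (sym (inverseˡ φ)) (cong (φ ⟨$⟩ˡ_) (sym (π'≗φπ i)))

concatPerm-∘ : ∀ m k (f₁ g₁ : Fin m → Fin m) (f₂ g₂ : Fin k → Fin k) i →
               concatPerm m k (f₁ ∘ g₁) (f₂ ∘ g₂) i ≡ concatPerm m k f₁ f₂ (concatPerm m k g₁ g₂ i)
concatPerm-∘ m k f₁ g₁ f₂ g₂ i = cong (join m k) $ begin
  Sum.map (f₁ ∘ g₁) (f₂ ∘ g₂) (splitAt m i)        ≡⟨ map-map (splitAt m i) ⟨
  Sum.map f₁ f₂ inner                              ≡⟨ cong (Sum.map f₁ f₂) (splitAt-join m k inner) ⟨
  Sum.map f₁ f₂ (splitAt m (join m k inner))       ∎
  where
  open ≡-Reasoning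
  inner : Fin m Sum.⊎ Fin k
  inner = Sum.map g₁ g₂ (splitAt m i)

-- Its forward map is definitionally concatPerm m k opposite opposite.
reverseBlocks : ∀ m k → Permutation′ (m + k)
reverseBlocks m k = ↔-sym (+↔⊎ {m} {k}) ↔-∘ ((reverse ⊎-↔ reverse) ↔-∘ +↔⊎ {m} {k})

lemma3p10 : (m k : ℕ) → 0 < k → (μ : Vec ℕ (m + k))
    → (π₁ : Permutation′ m) → (π₂ : Permutation′ k)
    → NAF (concatPerm m k (π₁ ⟨$⟩ʳ_) (π₂ ⟨$⟩ʳ_)) μ
    ⤖ NAF (concatPerm m k (compl (π₁ ⟨$⟩ʳ_)) (compl (π₂ ⟨$⟩ʳ_))) μ
lemma3p10 m k _ μ π₁ π₂ =
  NAF-relabel-⤖ (reverseBlocks m k) (concatPerm-∘ m k opposite (π₁ ⟨$⟩ʳ_) opposite (π₂ ⟨$⟩ʳ_))
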